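{- Any countable collection $\mathcal C=\{L_0,L_1,\dots\}$ of languages can be non-uniformly identified with feedback.
   Context: A language is an infinite subset of a countably infinite universe $U$; the collection is given with an explicit indexing $L_0,L_1,\dots$. An enumeration of $K$ is an infinite sequence $x_0,x_1,\dots$ of pairwise distinct elements of $K$ containing every element of $K$. An identifier algorithm with feedback is a function $G$: at each time $t$ the adversary reveals $x_t$, the algorithm asks a membership query $y_t=G(x_0,a_0,\dots,a_{t-1},x_t)\in U$, receives $a_t\in\{\mathrm{Yes},\mathrm{No}\}$ indicating whether $y_t\in K$, and outputs an index $z_t=G(x_0,a_0,\dots,x_t,a_t)\in\mathbb N$. $G$ non-uniformly identifies with feedback for $\mathcal C$ if for every $K\in\mathcal C$ there exists $t^\star$ such that for every enumeration of $K$, $L_{z_t}=K$ for all $t\ge t^\star$. -}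

module Defs where

open import Data.Nat using (ℕ; zero; suc; _≤_)
open import Data.Bool using (Bool; true; false)
open import Data.Product using (Σ; ∃; _×_; _,_)
open import Data.List using (List; []; _∷ʳ_)
open import Data.List.Membership.Propositional using (_∉_)
open import Relation.Binary.PropositionalEquality using (_≡_)
open import Function.Definitions using (Injective)

-- A subset of the universe U, given by its characteristic function
-- (true = member, i.e. the oracle answer "Yes").
Subset : Set → Set
Subset U = U → Bool

Infinite : {U : Set} → Subset U → Set
Infinite {U} K = (xs : List U) → ∃ λ x → K x ≡ true × x ∉ xs

_≐_ : {U : Set} → Subset U → Subset U → Set
_≐_ {U} A B = (x : U) → A x ≡ B x

IsEnumeration : {U : Set} → Subset U → (ℕ → U) → Set
IsEnumeration {U} K e =
  Injective _≡_ _≡_ e × ((n : ℕ) → K (e n) ≡ true)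
  × ((x : U) → K x ≡ true → ∃ λ n → e n ≡ x)

-- A history is the chronological list
-- of pairs (x_i , a_i).
--   query h x_t   = y_t  (h = (x_0,a_0) … (x_{t-1},a_{t-1}))
--   guess h'      = z_t  (h' = (x_0,a_0) … (x_t,a_t))
record Identifier (U : Set) : Set where
  field
    query : List (U × Bool) → U → U
    guess : List (U × Bool) → ℕ
open Identifier public

history : {U : Set} → Identifier U → Subset U → (ℕ → U) → ℕ → List (U × Bool)
history G K e zero = []
history G K e (suc t) =
  history G K e t ∷ʳ (e t , K (query G (history G K e t) (e t)))

output : {U : Set} → Identifier U → Subset U → (ℕ → U) → ℕ → ℕ
output G K e t = guess G (history G K e (suc t))

NonUniformlyIdentifiesWithFeedback :
  {U : Set} → Identifier U → (ℕ → Subset U) → Set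
NonUniformlyIdentifiesWithFeedback {U} G L =
  (K : Subset U) → (∃ λ i → L i ≐ K) →
  ∃ λ tstar → (e : ℕ → U) → IsEnumeration K e →
    (t : ℕ) → tstar ≤ t → L (output G K e t) ≐ K

-- Enumerate U as u 0, u 1, … and at time t query u t, ignoring the revealed
-- x_t: the answers are then an initial segment of the characteristic sequence
-- K ∘ u, and the guess is the least index j whose language agrees with them.
-- If K = L i, each L j with j < i either equals K or differs from it at some
-- point; excluded middle decides which, these finitely many points have a
-- common bound N, and from time max N i on the guess is an index of K.
module Submission where

open import Defs
open import Data.Nat using (ℕ)
open import Data.Product using (Σ)
open import Function.Bundles using (_↔_)
open import Level using (0ℓ)
open import Axiom.ExcludedMiddle using (ExcludedMiddle)

open import Data.Nat using (zero; suc; _≤_; _<_; _⊔_; z≤n; s≤s)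
open import Data.Nat.Properties
  using (≤-refl; ≤-trans; <-≤-trans; ≤-pred; m≤n⇒m<n∨m≡n; m≤m⊔n; m≤n⊔m; m≤n⇒m≤1+n)
open import Data.Bool using (Bool) renaming (_≟_ to _≟ᴮ_)
open import Data.Product using (_×_; _,_; ∃; proj₁; proj₂; map₂)
open import Data.Sum using (_⊎_; inj₁; inj₂; [_,_])
open import Data.List using (List; _∷_; _∷ʳ_; length; map; applyUpTo)
open import Data.List.Properties
  using (∷-injective; ≡-dec; length-applyUpTo; applyUpTo-∷ʳ; map-applyUpTo)
open import Function using (_∘_)
open import Function.Bundles using (Inverse)
open import Relation.Nullary using (Dec; yes; no; contradiction)
open import Relation.Nullary.Decidable using (decidable-stable)
open import Relation.Unary using (Pred; Decidable)
open import Relation.Binary.Definitions using (DecidableEquality)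
open import Relation.Binary.PropositionalEquality
  using (_≡_; _≢_; _≗_; refl; sym; trans; cong; cong₂; subst; module ≡-Reasoning)

-- The least j ≤ n satisfying P; when there is none the result is n.
least : ∀ {p} {P : Pred ℕ p} → Decidable P → ℕ → ℕ
least P? zero = zero
least P? (suc n) with P? zero
... | yes _ = zero
... | no _ = suc (least (P? ∘ suc) n)

least-spec : ∀ {p} {P : Pred ℕ p} (P? : Decidable P) n {j} →
             j ≤ n → P j → P (least P? n) × least P? n ≤ j
least-spec P? zero z≤n Pj = Pj , z≤n
least-spec P? (suc n) j≤n Pj with P? zero
... | yes P0 = P0 , z≤n
least-spec P? (suc n) {zero} _ Pj | no ¬P0 = contradiction Pj ¬P0
least-spec P? (suc n) {suc j} (s≤s j≤n) Pj | no _ =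
  map₂ s≤s (least-spec (P? ∘ suc) n j≤n Pj)

common-bound : ∀ {p} (P : ℕ → ℕ → Set p) →
               (∀ {j m n} → m ≤ n → P j m → P j n) →
               (∀ j → ∃ (P j)) →
               ∀ i → ∃ λ N → ∀ {j} → j < i → P j N
common-bound P mono bound zero = 0 , λ ()
common-bound P mono bound (suc i) with common-bound P mono bound i | bound i
... | N , below | M , at = N ⊔ M , λ j<1+i →
  [ (λ j<i → mono (m≤m⊔n N M) (below j<i))
  , (λ { refl → mono (m≤n⊔m N M) at })
  ] (m≤n⇒m<n∨m≡n (≤-pred j<1+i))

module _ {a} {A : Set a} where

  applyUpTo-cong : ∀ {φ ψ : ℕ → A} → φ ≗ ψ → ∀ n → applyUpTo φ n ≡ applyUpTo ψ n
  applyUpTo-cong φ≗ψ zero = refl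
  applyUpTo-cong φ≗ψ (suc n) =
    cong₂ _∷_ (φ≗ψ 0) (applyUpTo-cong (φ≗ψ ∘ suc) n)

  applyUpTo-≡⇒≡ : ∀ (φ ψ : ℕ → A) {k n} →
                  applyUpTo φ n ≡ applyUpTo ψ n → k < n → φ k ≡ ψ k
  applyUpTo-≡⇒≡ φ ψ {zero} {suc n} eq _ = proj₁ (∷-injective eq)
  applyUpTo-≡⇒≡ φ ψ {suc k} {suc n} eq (s≤s k<n) =
    applyUpTo-≡⇒≡ (φ ∘ suc) (ψ ∘ suc) (proj₂ (∷-injective eq)) k<n

module Learning {A : Set} (_≟_ : DecidableEquality A) where

  Consistent : (ℕ → A) → List A → Set
  Consistent φ as = applyUpTo φ (length as) ≡ as

  consistent? : ∀ φ as → Dec (Consistent φ as)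
  consistent? φ as = ≡-dec _≟_ (applyUpTo φ (length as)) as

  consistent-applyUpTo : ∀ {φ ψ} → φ ≗ ψ → ∀ n → Consistent φ (applyUpTo ψ n)
  consistent-applyUpTo {φ} {ψ} φ≗ψ n =
    trans (cong (applyUpTo φ) (length-applyUpTo ψ n)) (applyUpTo-cong φ≗ψ n)

  consistent⇒≡ : ∀ {φ ψ as k} → Consistent φ as → Consistent ψ as →
                 k < length as → φ k ≡ ψ k
  consistent⇒≡ {φ} {ψ} φ∼as ψ∼as = applyUpTo-≡⇒≡ φ ψ (trans φ∼as (sym ψ∼as))

  learn : (ℕ → ℕ → A) → List A → ℕ
  learn f as = least (λ j → consistent? (f j) as) (length as)

  SettledBelow : ℕ → (ℕ → A) → (ℕ → A) → Set
  SettledBelow N φ ψ = φ ≗ ψ ⊎ ∃ λ k → k < N × φ k ≢ ψ k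

  settledBelow-mono : ∀ {φ ψ m n} → m ≤ n → SettledBelow m φ ψ → SettledBelow n φ ψ
  settledBelow-mono m≤n (inj₁ φ≗ψ) = inj₁ φ≗ψ
  settledBelow-mono m≤n (inj₂ (k , k<m , φk≢ψk)) = inj₂ (k , <-≤-trans k<m m≤n , φk≢ψk)

  settled : ExcludedMiddle 0ℓ → ∀ φ ψ → ∃ λ N → SettledBelow N φ ψ
  settled lem φ ψ with lem {∃ λ k → φ k ≢ ψ k}
  ... | yes (k , φk≢ψk) = suc k , inj₂ (k , s≤s ≤-refl , φk≢ψk)
  ... | no ¬differs = 0 , inj₁ λ k → decidable-stable (φ k ≟ ψ k) (λ φk≢ψk → ¬differs (k , φk≢ψk))

  learn-converges : ExcludedMiddle 0ℓ → ∀ (f : ℕ → ℕ → A) i → ∃ λ N →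
                    ∀ as → N ≤ length as → Consistent (f i) as → f (learn f as) ≗ f i
  learn-converges lem f i
    with common-bound (λ j N → SettledBelow N (f j) (f i)) settledBelow-mono
                      (λ j → settled lem (f j) (f i)) i
  ... | N , settledBelowN = N ⊔ i , converges
    where
    converges : ∀ as → N ⊔ i ≤ length as → Consistent (f i) as → f (learn f as) ≗ f i
    converges as N⊔i≤n fi∼as
      with least-spec (λ j → consistent? (f j) as) (length as)
                      (≤-trans (m≤n⊔m N i) N⊔i≤n) fi∼as
    ... | fj∼as , j≤i with m≤n⇒m<n∨m≡n j≤i
    ...   | inj₂ j≡i = λ k → cong (λ j → f j k) j≡i
    ...   | inj₁ j<i with settledBelowN j<i
    ...     | inj₁ fj≗fi = fj≗fi
    ...     | inj₂ (k , k<N , fjk≢fik) = contradiction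
                (consistent⇒≡ fj∼as fi∼as (<-≤-trans k<N (≤-trans (m≤m⊔n N i) N⊔i≤n)))
                fjk≢fik

module _ {U : Set} (U↔ℕ : U ↔ ℕ) (L : ℕ → Subset U) where

  open Inverse U↔ℕ using (from; strictlyInverseʳ)
  open Learning _≟ᴮ_

  feedbackLearner : Identifier U
  feedbackLearner = record
    { query = λ h _ → from (length h)
    ; guess = λ h → learn (λ j → L j ∘ from) (map proj₂ h)
    }

  ≐-from-≗ : ∀ {A B : Subset U} → A ∘ from ≗ B ∘ from → A ≐ B
  ≐-from-≗ {A} {B} eq x =
    subst (λ y → A y ≡ B y) (strictlyInverseʳ x) (eq (Inverse.to U↔ℕ x))

  module _ (K : Subset U) (e : ℕ → U) where

    history≡applyUpTo : ∀ t →
      history feedbackLearner K e t ≡ applyUpTo (λ k → e k , K (from k)) t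
    history≡applyUpTo zero = refl
    history≡applyUpTo (suc t) = begin
      h t ∷ʳ (e t , K (from (length (h t))))
        ≡⟨ cong (λ h′ → h′ ∷ʳ (e t , K (from (length h′)))) (history≡applyUpTo t) ⟩
      applyUpTo r t ∷ʳ (e t , K (from (length (applyUpTo r t))))
        ≡⟨ cong (λ n → applyUpTo r t ∷ʳ (e t , K (from n))) (length-applyUpTo r t) ⟩
      applyUpTo r t ∷ʳ r t
        ≡⟨ applyUpTo-∷ʳ r t ⟩
      applyUpTo r (suc t) ∎
      where
      open ≡-Reasoning
      h : ℕ → List (U × Bool)
      h = history feedbackLearner K e
      r : ℕ → U × Bool
      r k = e k , K (from k)

    answers≡applyUpTo : ∀ t → map proj₂ (history feedbackLearner K e t) ≡ applyUpTo (K ∘ from) t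
    answers≡applyUpTo t =
      trans (cong (map proj₂) (history≡applyUpTo t)) (map-applyUpTo _ proj₂ t)

    length-answers : ∀ t → length (map proj₂ (history feedbackLearner K e t)) ≡ t
    length-answers t =
      trans (cong length (answers≡applyUpTo t)) (length-applyUpTo (K ∘ from) t)

    consistent-answers : ∀ {i} → L i ≐ K → ∀ t →
      Consistent (L i ∘ from) (map proj₂ (history feedbackLearner K e t))
    consistent-answers Lᵢ≐K t = subst (Consistent _) (sym (answers≡applyUpTo t))
      (consistent-applyUpTo (Lᵢ≐K ∘ from) t)

  identifies : ExcludedMiddle 0ℓ → NonUniformlyIdentifiesWithFeedback feedbackLearner L
  identifies lem K (i , Lᵢ≐K) with learn-converges lem (λ j → L j ∘ from) i
  ... | N , converges = N , λ e _ t N≤t x → trans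
    (≐-from-≗ (converges _
      (subst (N ≤_) (sym (length-answers K e (suc t))) (m≤n⇒m≤1+n N≤t))
      (consistent-answers K e Lᵢ≐K (suc t))) x)
    (Lᵢ≐K x)

theorem6p4 : ExcludedMiddle 0ℓ → (U : Set) → U ↔ ℕ →
    (L : ℕ → Subset U) → ((i : ℕ) → Infinite (L i)) →
    Σ (Identifier U) (λ G → NonUniformlyIdentifiesWithFeedback G L)
theorem6p4 lem U U↔ℕ L _ = feedbackLearner U↔ℕ L , identifies U↔ℕ L lem
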